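{- Let $\varphi$ be a normal form $\mathrm{GF}^2[{\downarrow_{+}}]$ formula and let $\mathfrak{T}$ be a finite tree with $\mathfrak{T}\models\varphi$. Then there exists a submodel $\mathfrak{T}'\models\varphi$ of $\mathfrak{T}$ in which the number of children of each node is bounded by $\mathit{max}\cdot|\varphi|$, where $\mathit{max}$ is the length of the longest path in $\mathfrak{T}$.
   Context: Structures: finite unranked trees over $\tau_0\cup\{{\downarrow_{+}}\}$, $\tau_0$ unary symbols (arbitrary), $x{\downarrow_{+}}y$ meaning $y$ is a proper descendant of $x$; a submodel is a substructure of $\mathfrak{T}$ (which is again such a tree). A $\mathrm{GF}^2[{\downarrow_{+}}]$ formula is in normal form if it is $\bigwedge_{i\in I}\forall xy(\eta_i(x,y)\Rightarrow\psi_i(x,y))\wedge\bigwedge_{i\in J}\forall x(\lambda_i(x)\Rightarrow\exists y(\eta_i(x,y)\wedge\psi_i(x,y)))$ for disjoint index sets $I,J$, where each $\eta_i$ is one of $x{\downarrow_{+}}y$, $y{\downarrow_{+}}x$, $x{=}y$, each $\lambda_i(x)$ is a unary atom, and each $\psi_i$ is a boolean combination of unary atoms. $|\varphi|$ is the length of $\varphi$. -}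

module Defs where

open import Data.Nat using (ℕ; zero; suc; _+_; _*_; _⊔_)
open import Data.Bool using (Bool; true; false; _∧_; not; if_then_else_)
open import Data.Fin using (Fin)
open import Data.List using (List; []; _∷_; map; foldr; allFin)
open import Data.Nat.ListAction using (sum)
open import Data.Bool.ListAction using (any)
open import Data.List.Relation.Unary.All using (All)
open import Data.Product using (Σ; _×_; _,_)
open import Data.Sum using (_⊎_)
open import Data.Empty using (⊥)
open import Data.Unit using (⊤)
open import Relation.Nullary using (¬_)
open import Relation.Binary.PropositionalEquality using (_≡_; _≢_)

-- Signature: unary symbols τ₀ (indexed by ℕ, an arbitrary supply) plus ↓₊.

Sym : Set
Sym = ℕ

record Structure : Set₁ where
  field
    Carrier : Set
    down    : Carrier → Carrier → Set   -- down x y  :  x ↓₊ y  (y proper descendant of x)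
    holds   : Sym → Carrier → Set

open Structure public

record IsTree (M : Structure) : Set where
  field
    irrefl : ∀ x → ¬ down M x x
    trans  : ∀ x y z → down M x y → down M y z → down M x z
    root   : Σ (Carrier M) λ r → ∀ v → v ≢ r → down M r v
    linear : ∀ x y z → down M x z → down M y z →
             (x ≡ y) ⊎ (down M x y ⊎ down M y x)

record FinStr : Set where
  field
    size  : ℕ
    dn    : Fin size → Fin size → Bool
    lab   : Sym → Fin size → Bool

open FinStr public

toStr : FinStr → Structure
toStr T = record
  { Carrier = Fin (size T)
  ; down    = λ x y → dn T x y ≡ true
  ; holds   = λ P x → lab T P x ≡ true }

restrict : (T : FinStr) → (Fin (size T) → Bool) → Structure
restrict T S = record
  { Carrier = Σ (Fin (size T)) (λ v → S v ≡ true)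
  ; down    = λ { (x , _) (y , _) → dn T x y ≡ true }
  ; holds   = λ { P (x , _) → lab T P x ≡ true } }

data Var : Set where
  vx vy : Var

data BForm : Set where
  atom : Sym → Var → BForm
  tt   : BForm
  neg  : BForm → BForm
  conj : BForm → BForm → BForm
  disj : BForm → BForm → BForm

data Guard : Set where
  x↓y : Guard
  y↓x : Guard
  x=y : Guard

-- ∀xy (η(x,y) ⇒ ψ(x,y))
record UConj : Set where
  constructor ∀c
  field
    guard : Guard
    body  : BForm

-- ∀x (λ(x) ⇒ ∃y (η(x,y) ∧ ψ(x,y))), λ(x) = P(x)
record EConj : Set where
  constructor ∃c
  field
    trigger : Sym
    guard   : Guard
    body    : BForm

record NF : Set where
  constructor nf
  field
    univs : List UConj
    exs   : List EConj

evalB : (M : Structure) → Carrier M → Carrier M → BForm → Set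
evalB M a b (atom P vx) = holds M P a
evalB M a b (atom P vy) = holds M P b
evalB M a b tt          = ⊤
evalB M a b (neg ψ)     = ¬ evalB M a b ψ
evalB M a b (conj ψ χ)  = evalB M a b ψ × evalB M a b χ
evalB M a b (disj ψ χ)  = evalB M a b ψ ⊎ evalB M a b χ

evalG : (M : Structure) → Carrier M → Carrier M → Guard → Set
evalG M a b x↓y = down M a b
evalG M a b y↓x = down M b a
evalG M a b x=y = a ≡ b

SatU : (M : Structure) → UConj → Set
SatU M (∀c η ψ) = ∀ a b → evalG M a b η → evalB M a b ψ

SatE : (M : Structure) → EConj → Set
SatE M (∃c P η ψ) = ∀ a → holds M P a → Σ (Carrier M) λ b → evalG M a b η × evalB M a b ψ

_⊨_ : Structure → NF → Set
M ⊨ nf us es = All (SatU M) us × All (SatE M) es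

-- length |φ| (symbol count)
lenB : BForm → ℕ
lenB (atom _ _) = 1
lenB tt         = 1
lenB (neg ψ)    = suc (lenB ψ)
lenB (conj ψ χ) = suc (lenB ψ + lenB χ)
lenB (disj ψ χ) = suc (lenB ψ + lenB χ)

-- ∀xy, guard, ⇒, body
lenU : UConj → ℕ
lenU (∀c _ ψ) = 3 + lenB ψ

-- ∀x, λ, ⇒, ∃y, guard, ∧, body
lenE : EConj → ℕ
lenE (∃c _ _ ψ) = 6 + lenB ψ

-- conjuncts plus the connecting ∧'s
len : NF → ℕ
len (nf us es) = sum (map lenU us) + sum (map lenE es) + sum (map (λ _ → 1) us) + sum (map (λ _ → 1) es)

count : {n : ℕ} → (Fin n → Bool) → ℕ
count {n} f = sum (map (λ u → if f u then 1 else 0) (allFin n))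

-- depth of v = number of proper ancestors = length (in edges) of the root-to-v path
depth : (T : FinStr) → Fin (size T) → ℕ
depth T v = count (λ u → dn T u v)

-- length (number of edges) of the longest path in T
maxPath : FinStr → ℕ
maxPath T = foldr _⊔_ 0 (map (depth T) (allFin (size T)))

childCount : (T : FinStr) → (Fin (size T) → Bool) → Fin (size T) → ℕ
childCount T S x =
  count (λ v → S v ∧ dn T x v ∧ not (any (λ z → S z ∧ dn T x z ∧ dn T z v) (allFin (size T))))

-- For each node c and each existential conjunct ∀x(P(x) ⇒ ∃y(x ↓₊ y ∧ ψ)) with P(c), fix one
-- witness below c.  Call u justified if it lies strictly below some c and on or above one of c's
-- witnesses, and keep v iff every node on the path from the root to v is the root or justified.
-- The kept set contains the root, is closed under ancestors and contains the chosen witnesses of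
-- kept nodes, so it induces a subtree satisfying φ: universal conjuncts pass to substructures,
-- upward and reflexive existentials are witnessed by ancestors.  A kept child v of a is justified
-- by some c that is a or an ancestor of a (otherwise c would be kept strictly between a and v), and
-- v lies above a witness of c.  Distinct children are incomparable, hence lie above distinct
-- witnesses, so a has at most (depth a + 1)·|J| ≤ max·|φ| children.
module Submission where

open import Axiom.UniquenessOfIdentityProofs using (module Decidable⇒UIP)
open import Data.Bool using (Bool; true; false; _∧_; _∨_; not; if_then_else_)
open import Data.Bool.ListAction using (any)
open import Data.Bool.Properties
  using (∧-conicalˡ; ∧-conicalʳ; ∨-zeroʳ; ¬-not; T-≡) renaming (_≟_ to _≟ᵇ_)
open import Data.Fin using (Fin)
open import Data.Fin.Properties using (_≟_; all?; any?)
open import Data.List using (List; []; _∷_; _++_; map; foldr; length; allFin)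
open import Data.List.Membership.Propositional using (_∈_; find; lose)
open import Data.List.Membership.Propositional.Properties using (∈-allFin; ∈-++⁺ˡ; ∈-++⁺ʳ)
open import Data.List.Properties using (length-++)
open import Data.List.Relation.Binary.Subset.Propositional using (_⊆_)
open import Data.List.Relation.Unary.All as All using (All; []; _∷_)
open import Data.List.Relation.Unary.Any as Any using (Any; here; there)
open import Data.List.Relation.Unary.Any.Properties using (any⁺)
open import Data.List.Relation.Unary.Unique.Propositional using (Unique; []; _∷_)
open import Data.List.Relation.Unary.Unique.Propositional.Properties using (allFin⁺)
open import Data.Nat using (ℕ; suc; _+_; _*_; _≤_; _⊔_; z≤n; s≤s)
open import Data.Nat.ListAction using (sum)
open import Data.Nat.Properties
  using (≤-trans; ≤-reflexive; +-comm; +-suc; +-mono-≤; +-monoˡ-≤; +-monoʳ-≤; *-monoʳ-≤; *-monoˡ-≤;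
         m≤m⊔n; m≤n⊔m; m≤n+m; n≤1+n; module ≤-Reasoning)
open import Data.Product using (Σ; ∃; _×_; _,_; proj₁; proj₂)
open import Data.Product.Function.NonDependent.Propositional using (_×-⇔_)
open import Data.Sum using (_⊎_; inj₁; inj₂)
open import Data.Sum.Function.Propositional using (_⊎-⇔_)
open import Function using (_∘_; id; case_of_)
open import Function.Bundles using (_⇔_; Equivalence)
open import Function.Properties.Equivalence using () renaming (refl to ⇔-refl)
open import Function.Related.TypeIsomorphisms using (¬-cong-⇔)
open import Relation.Binary.PropositionalEquality
  using (_≡_; _≢_; refl; sym; trans; cong; cong₂; subst)
open import Relation.Nullary
  using (¬_; Dec; yes; no; does; contradiction; _×-dec_; _⊎-dec_; _→-dec_)
open import Relation.Nullary.Decidable using (dec-true)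

open import Defs

does≡true⇒ : ∀ {P : Set} (p? : Dec P) → does p? ≡ true → P
does≡true⇒ (yes p) _ = p

not≡true⇒ : ∀ {b} → not b ≡ true → b ≡ false
not≡true⇒ {false} _ = refl

module _ {A : Set} where

  countIn : (A → Bool) → List A → ℕ
  countIn p xs = sum (map (λ u → if p u then 1 else 0) xs)

  countIn-mono : ∀ {p q : A → Bool} xs → (∀ {u} → p u ≡ true → q u ≡ true) →
                 countIn p xs ≤ countIn q xs
  countIn-mono {p} {q} [] p⇒q = z≤n
  countIn-mono {p} {q} (x ∷ xs) p⇒q with p x in px | q x in qx
  ... | true  | true  = s≤s (countIn-mono xs p⇒q)
  ... | true  | false = contradiction (trans (sym (p⇒q px)) qx) λ ()
  ... | false | true  = ≤-trans (countIn-mono xs p⇒q) (n≤1+n _)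
  ... | false | false = countIn-mono xs p⇒q

  countIn-split : ∀ (p q : A → Bool) xs →
                  countIn p xs ≡ countIn (λ u → p u ∧ q u) xs + countIn (λ u → p u ∧ not (q u)) xs
  countIn-split p q [] = refl
  countIn-split p q (x ∷ xs) with p x | q x
  ... | true  | true  = cong suc (countIn-split p q xs)
  ... | true  | false = trans (cong suc (countIn-split p q xs)) (sym (+-suc _ _))
  ... | false | _     = countIn-split p q xs

  countIn-∨ : ∀ (p q : A → Bool) xs → countIn (λ u → p u ∨ q u) xs ≤ countIn p xs + countIn q xs
  countIn-∨ p q [] = z≤n
  countIn-∨ p q (x ∷ xs) with p x | q x
  ... | true  | true  = s≤s (≤-trans (countIn-∨ p q xs) (+-monoʳ-≤ (countIn p xs) (n≤1+n _)))
  ... | true  | false = s≤s (countIn-∨ p q xs)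
  ... | false | true  = ≤-trans (s≤s (countIn-∨ p q xs)) (≤-reflexive (sym (+-suc _ _)))
  ... | false | false = countIn-∨ p q xs

  countIn-∈ : ∀ (p : A → Bool) {u xs} → u ∈ xs → p u ≡ true → 1 ≤ countIn p xs
  countIn-∈ p {xs = x ∷ xs} (here refl) pu rewrite pu = s≤s z≤n
  countIn-∈ p {xs = x ∷ xs} (there u∈xs) pu with p x
  ... | true  = s≤s z≤n
  ... | false = countIn-∈ p u∈xs pu

  countIn-≤-fromHit : ∀ (p : A → Bool) xs {m} →
                      (∀ {u} → u ∈ xs → p u ≡ true → countIn p xs ≤ m) → countIn p xs ≤ m
  countIn-≤-fromHit p [] bound = z≤n
  countIn-≤-fromHit p (x ∷ xs) bound with p x in px
  ... | true  = bound (here refl) px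
  ... | false = countIn-≤-fromHit p xs (bound ∘ there)

  countIn-≤1 : ∀ (p : A → Bool) {xs} → Unique xs →
               (∀ {u v} → p u ≡ true → p v ≡ true → u ≡ v) → countIn p xs ≤ 1
  countIn-≤1 p [] one = z≤n
  countIn-≤1 p {x ∷ xs} (x∉xs ∷ uniq) one with p x in px
  ... | true  = s≤s (countIn-≤-fromHit p xs λ u∈xs pu →
                       contradiction (one px pu) (All.lookup x∉xs u∈xs))
  ... | false = countIn-≤1 p uniq one

  -- Union bound over the fibres of R · l, each of which contains at most one hit.
  countIn-≤-length : ∀ {B : Set} (p : A → Bool) (R : A → B → Bool) {xs} → Unique xs → (L : List B) →
                     (∀ {v} → p v ≡ true → ∃ λ l → l ∈ L × R v l ≡ true) →
                     (∀ {l v w} → p v ≡ true → p w ≡ true → R v l ≡ true → R w l ≡ true → v ≡ w) →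
                     countIn p xs ≤ length L
  countIn-≤-length p R {xs} uniq [] covers injective =
    countIn-≤-fromHit p xs λ _ pv → case covers pv of λ { (_ , () , _) }
  countIn-≤-length p R {xs} uniq (l ∷ L) covers injective = begin
    countIn p xs
      ≡⟨ countIn-split p (λ v → R v l) xs ⟩
    countIn (λ v → p v ∧ R v l) xs + countIn (λ v → p v ∧ not (R v l)) xs
      ≤⟨ +-mono-≤ (countIn-≤1 _ uniq λ u v → injective (∧ˡ u) (∧ˡ v) (∧ʳ u) (∧ʳ v))
                  (countIn-≤-length _ R uniq L covers′ λ u v → injective (∧ˡ u) (∧ˡ v)) ⟩
    1 + length L ∎
    where
    open ≤-Reasoning
    ∧ˡ : ∀ {a b} → a ∧ b ≡ true → a ≡ true
    ∧ˡ = ∧-conicalˡ _ _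
    ∧ʳ : ∀ {a b} → a ∧ b ≡ true → b ≡ true
    ∧ʳ = ∧-conicalʳ _ _
    covers′ : ∀ {v} → p v ∧ not (R v l) ≡ true → ∃ λ l′ → l′ ∈ L × R v l′ ≡ true
    covers′ e with covers (∧ˡ e)
    ... | l′ , there l′∈L , r = l′ , l′∈L , r
    ... | _  , here refl  , r = contradiction (trans (sym r) (not≡true⇒ (∧ʳ e))) λ ()

  ≤-foldr-⊔ : ∀ (g : A → ℕ) {u xs} → u ∈ xs → g u ≤ foldr _⊔_ 0 (map g xs)
  ≤-foldr-⊔ g (here refl)  = m≤m⊔n _ _
  ≤-foldr-⊔ g {xs = x ∷ _} (there u∈xs) = ≤-trans (≤-foldr-⊔ g u∈xs) (m≤n⊔m (g x) _)

  length≤sum-ones : (xs : List A) → length xs ≤ sum (map (λ _ → 1) xs)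
  length≤sum-ones []       = z≤n
  length≤sum-ones (x ∷ xs) = s≤s (length≤sum-ones xs)

  module _ {B : Set} (g : A → Bool) (f : A → List B) where

    gather : List A → List B
    gather []       = []
    gather (c ∷ cs) = (if g c then f c else []) ++ gather cs

    length-gather : ∀ {k} → (∀ c → length (f c) ≤ k) → ∀ xs → length (gather xs) ≤ countIn g xs * k
    length-gather bound [] = z≤n
    length-gather bound (c ∷ cs) with g c
    ... | true  = ≤-trans (≤-reflexive (length-++ (f c)))
                          (+-mono-≤ (bound c) (length-gather bound cs))
    ... | false = length-gather bound cs

    ∈-gather : ∀ {c l xs} → c ∈ xs → g c ≡ true → l ∈ f c → l ∈ gather xs
    ∈-gather (here refl) gc l∈fc rewrite gc = ∈-++⁺ˡ l∈fc
    ∈-gather {xs = x ∷ _} (there c∈xs) gc l∈fc =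
      ∈-++⁺ʳ (if g x then f x else []) (∈-gather c∈xs gc l∈fc)

module Tree (T : FinStr) (tree : IsTree (toStr T)) where

  open IsTree tree public using (irrefl; linear) renaming (trans to ↓₊-trans)

  n : ℕ
  n = size T

  _↓₊_ : Fin n → Fin n → Set
  x ↓₊ y = dn T x y ≡ true

  _⪯_ : Fin n → Fin n → Set
  u ⪯ v = u ≡ v ⊎ u ↓₊ v

  _⪯ᵇ_ : Fin n → Fin n → Bool
  u ⪯ᵇ v = does (u ≟ v) ∨ dn T u v

  ⪯ᵇ⇒⪯ : ∀ {u v} → u ⪯ᵇ v ≡ true → u ⪯ v
  ⪯ᵇ⇒⪯ {u} {v} e with u ≟ v
  ... | yes u≡v = inj₁ u≡v
  ... | no  _   = inj₂ e

  ⪯⇒⪯ᵇ : ∀ {u v} → u ⪯ v → u ⪯ᵇ v ≡ true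
  ⪯⇒⪯ᵇ {u} (inj₁ refl) = cong (_∨ dn T u u) (dec-true (u ≟ u) refl)
  ⪯⇒⪯ᵇ {u} (inj₂ u↓v)  = trans (cong (does (u ≟ _) ∨_) u↓v) (∨-zeroʳ _)

  ⪯? : ∀ u v → Dec (u ⪯ v)
  ⪯? u v = (u ≟ v) ⊎-dec (dn T u v ≟ᵇ true)

  ⪯-trans : ∀ {u v w} → u ⪯ v → v ⪯ w → u ⪯ w
  ⪯-trans (inj₁ refl) v⪯w         = v⪯w
  ⪯-trans (inj₂ u↓v)  (inj₁ refl) = inj₂ u↓v
  ⪯-trans (inj₂ u↓v)  (inj₂ v↓w)  = inj₂ (↓₊-trans _ _ _ u↓v v↓w)

  ⪯-linear : ∀ {u v x} → u ⪯ x → v ⪯ x → u ⪯ v ⊎ v ⪯ u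
  ⪯-linear (inj₁ refl) v⪯x         = inj₂ v⪯x
  ⪯-linear (inj₂ u↓x)  (inj₁ refl) = inj₁ (inj₂ u↓x)
  ⪯-linear (inj₂ u↓x)  (inj₂ v↓x) with linear _ _ _ u↓x v↓x
  ... | inj₁ u≡v        = inj₁ (inj₁ u≡v)
  ... | inj₂ (inj₁ u↓v) = inj₁ (inj₂ u↓v)
  ... | inj₂ (inj₂ v↓u) = inj₂ (inj₂ v↓u)

  root : Fin n
  root = proj₁ (IsTree.root tree)

  root↓₊ : ∀ v → v ≢ root → root ↓₊ v
  root↓₊ = proj₂ (IsTree.root tree)

  ¬↓₊root : ∀ u → ¬ u ↓₊ root
  ¬↓₊root u u↓r with u ≟ root
  ... | yes refl = irrefl root u↓r
  ... | no  u≢r  = irrefl u (↓₊-trans u root u u↓r (root↓₊ u u≢r))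

  countIn-⪯ᵇ≤1+depth : ∀ a → countIn (_⪯ᵇ a) (allFin n) ≤ suc (depth T a)
  countIn-⪯ᵇ≤1+depth a =
    ≤-trans (countIn-∨ (λ c → does (c ≟ a)) (λ c → dn T c a) (allFin n))
            (+-monoˡ-≤ (depth T a) (countIn-≤1 _ (allFin⁺ n) λ {u} {v} u≡a v≡a →
               trans (does≡true⇒ (u ≟ a) u≡a) (sym (does≡true⇒ (v ≟ a) v≡a))))

  depth-< : ∀ {a v} → a ↓₊ v → suc (depth T a) ≤ depth T v
  depth-< {a} {v} a↓v = begin
    suc (depth T a)
      ≡⟨ +-comm 1 _ ⟩
    depth T a + 1
      ≤⟨ +-mono-≤ (countIn-mono (allFin n) λ {u} u↓a → cong₂ _∧_ (↓₊-trans u a v u↓a a↓v) u↓a)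
                  (countIn-∈ _ (∈-allFin a) (cong₂ _∧_ a↓v (cong not a↛a))) ⟩
    countIn (λ u → dn T u v ∧ dn T u a) (allFin n) + countIn (λ u → dn T u v ∧ not (dn T u a)) (allFin n)
      ≡⟨ sym (countIn-split (λ u → dn T u v) (λ u → dn T u a) (allFin n)) ⟩
    depth T v ∎
    where
    open ≤-Reasoning
    a↛a : dn T a a ≡ false
    a↛a = ¬-not (irrefl a)

  depth≤maxPath : ∀ v → depth T v ≤ maxPath T
  depth≤maxPath v = ≤-foldr-⊔ (depth T) (∈-allFin v)

module Restriction (T : FinStr) (S : Fin (size T) → Bool) where

  private
    M = toStr T
    R = restrict T S

  restrict-≡ : ∀ {x y} (px : S x ≡ true) (py : S y ≡ true) → x ≡ y →
               _≡_ {A = Carrier R} (x , px) (y , py)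
  restrict-≡ px py refl = cong (_ ,_) (Decidable⇒UIP.≡-irrelevant _≟ᵇ_ px py)

  restrict-isTree : (tree : IsTree M) → S (Tree.root T tree) ≡ true → IsTree R
  restrict-isTree tree kept-root = record
    { irrefl = λ (x , _) → irrefl x
    ; trans  = λ (x , _) (y , _) (z , _) → ↓₊-trans x y z
    ; root   = (root , kept-root) , λ (v , pv) v≢r → root↓₊ v (v≢r ∘ restrict-≡ pv kept-root)
    ; linear = λ (x , px) (y , py) (z , _) x↓z y↓z → case linear x y z x↓z y↓z of λ where
        (inj₁ x≡y) → inj₁ (restrict-≡ px py x≡y)
        (inj₂ x↕y) → inj₂ x↕y
    }
    where open Tree T tree

  module _ {a b} (pa : S a ≡ true) (pb : S b ≡ true) where

    evalB-restrict : ∀ ψ → evalB M a b ψ ⇔ evalB R (a , pa) (b , pb) ψ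
    evalB-restrict (atom P vx) = ⇔-refl
    evalB-restrict (atom P vy) = ⇔-refl
    evalB-restrict tt          = ⇔-refl
    evalB-restrict (neg ψ)     = ¬-cong-⇔ (evalB-restrict ψ)
    evalB-restrict (conj ψ χ)  = evalB-restrict ψ ×-⇔ evalB-restrict χ
    evalB-restrict (disj ψ χ)  = evalB-restrict ψ ⊎-⇔ evalB-restrict χ

    evalG-restrict : ∀ η → evalG M a b η → evalG R (a , pa) (b , pb) η
    evalG-restrict x↓y g = g
    evalG-restrict y↓x g = g
    evalG-restrict x=y g = restrict-≡ pa pb g

  SatU-restrict : ∀ {u} → SatU M u → SatU R u
  SatU-restrict {∀c η ψ} sat (a , pa) (b , pb) g =
    Equivalence.to (evalB-restrict pa pb ψ) (sat a b (back η g))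
    where
    back : ∀ η → evalG R (a , pa) (b , pb) η → evalG M a b η
    back x↓y g = g
    back y↓x g = g
    back x=y g = cong proj₁ g

  SatE-restrict : ∀ P η ψ →
    (∀ {a} → S a ≡ true → lab T P a ≡ true →
       Σ (Fin (size T)) λ b → S b ≡ true × evalG M a b η × evalB M a b ψ) →
    SatE R (∃c P η ψ)
  SatE-restrict P η ψ witnessIn (a , pa) Pa with witnessIn pa Pa
  ... | b , pb , g , body =
    (b , pb) , evalG-restrict pa pb η g , Equivalence.to (evalB-restrict pa pb ψ) body

module Pruning (T : FinStr) (tree : IsTree (toStr T))
               (witnesses : Fin (size T) → List (Fin (size T))) where

  open Tree T tree

  Justified : Fin n → Set
  Justified u = ∃ λ c → c ↓₊ u × Any (u ⪯_) (witnesses c)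

  Kept : Fin n → Set
  Kept v = ∀ u → u ⪯ v → u ≡ root ⊎ Justified u

  Kept? : ∀ v → Dec (Kept v)
  Kept? v = all? λ u → ⪯? u v →-dec ((u ≟ root) ⊎-dec any? λ c →
              (dn T c u ≟ᵇ true) ×-dec Any.any? (⪯? u) (witnesses c))

  keep : Fin n → Bool
  keep v = does (Kept? v)

  kept⇒ : ∀ {v} → keep v ≡ true → Kept v
  kept⇒ {v} = does≡true⇒ (Kept? v)

  ⇒kept : ∀ {v} → Kept v → keep v ≡ true
  ⇒kept {v} = dec-true (Kept? v)

  keep-root : keep root ≡ true
  keep-root = ⇒kept λ where
    u (inj₁ u≡r) → inj₁ u≡r
    u (inj₂ u↓r) → contradiction u↓r (¬↓₊root u)

  keep-⪯ : ∀ {u v} → keep v ≡ true → u ⪯ v → keep u ≡ true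
  keep-⪯ kv u⪯v = ⇒kept λ w w⪯u → kept⇒ kv w (⪯-trans w⪯u u⪯v)

  keep-witness : ∀ {c w} → keep c ≡ true → c ↓₊ w → w ∈ witnesses c → keep w ≡ true
  keep-witness {c} kc c↓w w∈ = ⇒kept λ u u⪯w → case ⪯-linear u⪯w (inj₂ c↓w) of λ where
    (inj₁ u⪯c)         → kept⇒ kc u u⪯c
    (inj₂ (inj₁ refl)) → kept⇒ kc u (inj₁ refl)
    (inj₂ (inj₂ c↓u))  → inj₂ (c , c↓u , lose w∈ u⪯w)

  module Children (a : Fin n) where

    between : Fin n → Fin n → Bool
    between v z = keep z ∧ dn T a z ∧ dn T z v

    isChild : Fin n → Bool
    isChild v = keep v ∧ dn T a v ∧ not (any (between v) (allFin n))

    isChild⇒ : ∀ {v} → isChild v ≡ true →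
               keep v ≡ true × a ↓₊ v × (∀ {z} → keep z ≡ true → a ↓₊ z → ¬ z ↓₊ v)
    isChild⇒ {v} e with keep v | dn T a v | any (between v) (allFin n) in none
    ... | true | true | false = refl , refl , λ {z} kz a↓z z↓v →
      subst Data.Bool.T none (any⁺ (between v) (lose (∈-allFin z)
        (Equivalence.from T-≡ (cong₂ _∧_ kz (cong₂ _∧_ a↓z z↓v)))))

    children-⪯ : ∀ {v w} → isChild v ≡ true → isChild w ≡ true → v ⪯ w → v ≡ w
    children-⪯ cv cw (inj₁ v≡w) = v≡w
    children-⪯ cv cw (inj₂ v↓w) =
      let kv , a↓v , _ = isChild⇒ cv
          _  , _   , nothingBetween = isChild⇒ cw
      in  contradiction v↓w (nothingBetween kv a↓v)

    ancestorWitnesses : List (Fin n)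
    ancestorWitnesses = gather (_⪯ᵇ a) witnesses (allFin n)

    child-covered : ∀ {v} → isChild v ≡ true → ∃ λ l → l ∈ ancestorWitnesses × v ⪯ᵇ l ≡ true
    child-covered {v} cv with isChild⇒ cv
    ... | kv , a↓v , nothingbetween with kept⇒ kv v (inj₁ refl)
    ... | inj₁ refl = contradiction a↓v (¬↓₊root a)
    ... | inj₂ (c , c↓v , v⪯witness) with find v⪯witness
    ... | l , l∈ , v⪯l = l , ∈-gather (_⪯ᵇ a) witnesses (∈-allFin c) (⪯⇒⪯ᵇ c⪯a) l∈ , ⪯⇒⪯ᵇ v⪯l
      where
      c⪯a : c ⪯ a
      c⪯a with ⪯-linear (inj₂ c↓v) (inj₂ a↓v)
      ... | inj₁ c⪯a         = c⪯a
      ... | inj₂ (inj₁ refl) = inj₁ refl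
      ... | inj₂ (inj₂ a↓c)  = contradiction c↓v (nothingbetween (keep-⪯ kv (inj₂ c↓v)) a↓c)

    children-injective : ∀ {l v w} → isChild v ≡ true → isChild w ≡ true →
                         v ⪯ᵇ l ≡ true → w ⪯ᵇ l ≡ true → v ≡ w
    children-injective cv cw v⪯l w⪯l with ⪯-linear (⪯ᵇ⇒⪯ v⪯l) (⪯ᵇ⇒⪯ w⪯l)
    ... | inj₁ v⪯w = children-⪯ cv cw v⪯w
    ... | inj₂ w⪯v = sym (children-⪯ cw cv w⪯v)

    childCount-≤ : ∀ {k} → (∀ c → length (witnesses c) ≤ k) →
                   childCount T keep a ≤ suc (depth T a) * k
    childCount-≤ {k} bound = begin
      childCount T keep a
        ≤⟨ countIn-≤-length isChild _⪯ᵇ_ (allFin⁺ n) ancestorWitnesses child-covered children-injective ⟩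
      length ancestorWitnesses
        ≤⟨ length-gather (_⪯ᵇ a) witnesses bound (allFin n) ⟩
      countIn (_⪯ᵇ a) (allFin n) * k
        ≤⟨ *-monoˡ-≤ k (countIn-⪯ᵇ≤1+depth a) ⟩
      suc (depth T a) * k ∎
      where open ≤-Reasoning

  childCount≤maxPath*k : ∀ {k} → (∀ c → length (witnesses c) ≤ k) →
                         ∀ a → childCount T keep a ≤ maxPath T * k
  childCount≤maxPath*k {k} bound a = countIn-≤-fromHit isChild (allFin n) λ {v} _ cv →
    let _ , a↓v , _ = isChild⇒ cv
    in  ≤-trans (childCount-≤ bound) (*-monoˡ-≤ k (≤-trans (depth-< a↓v) (depth≤maxPath v)))
    where open Children a

length-exs≤len : ∀ us es → length es ≤ len (nf us es)
length-exs≤len us es = ≤-trans (length≤sum-ones es) (m≤n+m _ _)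

module _ (T : FinStr) where

  -- Only downward existentials need a chosen witness; the default c justifies nothing.
  witness : (e : EConj) → SatE (toStr T) e → Fin (size T) → Fin (size T)
  witness (∃c P x↓y ψ) sat c with lab T P c ≟ᵇ true
  ... | yes Pc = proj₁ (sat c Pc)
  ... | no  _  = c
  witness (∃c P y↓x ψ) sat c = c
  witness (∃c P x=y ψ) sat c = c

  witness-↓₊ : ∀ {P ψ} (sat : SatE (toStr T) (∃c P x↓y ψ)) c → lab T P c ≡ true →
               let w = witness (∃c P x↓y ψ) sat c in dn T c w ≡ true × evalB (toStr T) c w ψ
  witness-↓₊ {P} sat c Pc with lab T P c ≟ᵇ true
  ... | yes Pc′ = proj₂ (sat c Pc′)
  ... | no ¬Pc  = contradiction Pc ¬Pc

  witnessesFor : ∀ {es} → All (SatE (toStr T)) es → Fin (size T) → List (Fin (size T))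
  witnessesFor {[]}     []       c = []
  witnessesFor {e ∷ es} (s ∷ ss) c = witness e s c ∷ witnessesFor ss c

  length-witnessesFor : ∀ {es} (ss : All (SatE (toStr T)) es) c → length (witnessesFor ss c) ≡ length es
  length-witnessesFor []       c = refl
  length-witnessesFor (s ∷ ss) c = cong suc (length-witnessesFor ss c)

module Pruned (T : FinStr) (tree : IsTree (toStr T)) {es} (sat : All (SatE (toStr T)) es) where

  open Pruning T tree (witnessesFor T sat) public
  open Restriction T keep

  SatE-keep : ∀ e (s : SatE (toStr T) e) → (∀ c → witness T e s c ∈ witnessesFor T sat c) →
              SatE (restrict T keep) e
  SatE-keep (∃c P x↓y ψ) s chosen = SatE-restrict P x↓y ψ λ {c} kc Pc →
    let c↓w , body = witness-↓₊ T s c Pc in _ , keep-witness kc c↓w (chosen c) , c↓w , body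
  SatE-keep (∃c P y↓x ψ) s _ = SatE-restrict P y↓x ψ λ {c} kc Pc →
    let b , b↓c , body = s c Pc in b , keep-⪯ kc (inj₂ b↓c) , b↓c , body
  SatE-keep (∃c P x=y ψ) s _ = SatE-restrict P x=y ψ λ {c} kc Pc →
    let b , c≡b , body = s c Pc in b , keep-⪯ kc (inj₁ (sym c≡b)) , c≡b , body

  All-SatE-keep : ∀ {es′} (ss : All (SatE (toStr T)) es′) →
                  (∀ c → witnessesFor T ss c ⊆ witnessesFor T sat c) → All (SatE (restrict T keep)) es′
  All-SatE-keep {[]}    []       _      = []
  All-SatE-keep {e ∷ _} (s ∷ ss) chosen =
    SatE-keep e s (λ c → chosen c (here refl)) ∷ All-SatE-keep ss (λ c → chosen c ∘ there)

  keep-⊨ : ∀ {us} → All (SatU (toStr T)) us → restrict T keep ⊨ nf us es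
  keep-⊨ satU = All.map (λ {u} → SatU-restrict {u}) satU , All-SatE-keep sat (λ _ → id)

lemma10 : (φ : NF) (T : FinStr) → IsTree (toStr T) → toStr T ⊨ φ →
          Σ (Fin (size T) → Bool) λ S →
            IsTree (restrict T S) × (restrict T S ⊨ φ) ×
            (∀ x → S x ≡ true → childCount T S x ≤ maxPath T * len φ)
lemma10 (nf us es) T tree (satU , satE) =
  keep , restrict-isTree tree keep-root , keep-⊨ satU ,
  λ a _ → ≤-trans (childCount≤maxPath*k (λ c → ≤-reflexive (length-witnessesFor T satE c)) a)
                  (*-monoʳ-≤ (maxPath T) (length-exs≤len us es))
  where
  open Pruned T tree satE
  open Restriction T keep
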